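{- Let $L\cong M\perp K$ be a $\mathbb{Z}_2$-lattice, where $M$ has Gram matrix $2^a\begin{pmatrix}2&1\\1&2\end{pmatrix}$ and $K\cong\langle 2^b\beta\rangle\perp\langle 2^c\gamma\rangle$, with $a,b,c$ non-negative integers and $\beta,\gamma\in\mathbb{Z}_2^\times$. If the scale of $L$ is $\mathbb{Z}_2$ and $L$ is anisotropic, then $a,b,c$ are all even and $\beta+\gamma\equiv4\pmod{8\mathbb{Z}_2}$.
   Context: A $\mathbb{Z}_2$-lattice is a finitely generated $\mathbb{Z}_2$-submodule of a nondegenerate quadratic space over $\mathbb{Q}_2$ with quadratic map $q$ and bilinear form $B$, $q(v)=B(v,v)$. The Gram matrix is $(B(v_i,v_j))$ for a basis $v_i$; $\langle a\rangle$ is a rank one lattice spanned by $v$ with $q(v)=a$. The scale of $L$ is the $\mathbb{Z}_2$-ideal generated by $B(L,L)$. $L$ is anisotropic if $q(v)\ne0$ for all nonzero $v\in L$. -}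

module Defs where

open import Data.Nat as ℕ using (ℕ; _^_)
open import Data.Integer using (ℤ; +_; _+_; _-_; _*_)
open import Data.Integer.Divisibility using (_∣_)
open import Data.Fin using (Fin; zero; suc)
open import Data.List using (List; []; _∷_)
open import Data.Product using (_×_; _,_; Σ)
open import Relation.Nullary using (¬_)

-- 2-adic integers ℤ₂ = lim← ℤ/2ⁿℤ, represented by coherent sequences of
-- integer representatives: seq (suc n) ≡ seq n (mod 2ⁿ).

record ℤ₂ : Set where
  field
    seq : ℕ → ℤ
    coh : ∀ n → (+ (2 ^ n)) ∣ (seq (ℕ.suc n) - seq n)
open ℤ₂ public

-- "Raw" 2-adic expressions: pointwise-computed sequences of representatives.
-- They are only used inside the equality predicate _≈_ below, where
-- coherence is irrelevant (pointwise ring operations respect congruences).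
Raw : Set
Raw = ℕ → ℤ

⟦_⟧ : ℤ₂ → Raw
⟦ x ⟧ = seq x

infixl 6 _⊕_
infixl 7 _⊗_
_⊕_ : Raw → Raw → Raw
(x ⊕ y) n = x n + y n

_⊗_ : Raw → Raw → Raw
(x ⊗ y) n = x n * y n

cst : ℤ → Raw
cst k n = k

infix 4 _≈_
_≈_ : Raw → Raw → Set
x ≈ y = ∀ n → (+ (2 ^ n)) ∣ (x n - y n)

IsUnit : ℤ₂ → Set
IsUnit β = Σ ℤ₂ λ u → ⟦ β ⟧ ⊗ ⟦ u ⟧ ≈ cst (+ 1)

-- The lattice L = M ⊥ K with basis e₀,e₁ (of M) and e₂, e₃ (of K);
-- vectors of L are coordinate vectors Fin 4 → ℤ₂.

Vec4 : Set
Vec4 = Fin 4 → ℤ₂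

c : ℕ → Raw
c k = cst (+ k)

pow2 : ℕ → Raw
pow2 k = c (2 ^ k)

B : (a b c' : ℕ) (β γ : ℤ₂) → Vec4 → Vec4 → Raw
B a b c' β γ x y =
    pow2 a ⊗ ( c 2 ⊗ X 0 ⊗ Y 0 ⊕ X 0 ⊗ Y 1 ⊕ X 1 ⊗ Y 0 ⊕ c 2 ⊗ X 1 ⊗ Y 1 )
  ⊕ pow2 b ⊗ ⟦ β ⟧ ⊗ X 2 ⊗ Y 2
  ⊕ pow2 c' ⊗ ⟦ γ ⟧ ⊗ X 3 ⊗ Y 3
  where
    idx : ℕ → Fin 4
    idx 0 = zero
    idx 1 = suc zero
    idx 2 = suc (suc zero)
    idx _ = suc (suc (suc zero))
    X : ℕ → Raw
    X i = ⟦ x (idx i) ⟧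
    Y : ℕ → Raw
    Y i = ⟦ y (idx i) ⟧

Q : (a b c' : ℕ) (β γ : ℤ₂) → Vec4 → Raw
Q a b c' β γ v = B a b c' β γ v v

IsZeroVec : Vec4 → Set
IsZeroVec v = ∀ i → ⟦ v i ⟧ ≈ cst (+ 0)

Anisotropic : (a b c' : ℕ) (β γ : ℤ₂) → Set
Anisotropic a b c' β γ =
  ∀ v → ¬ IsZeroVec v → ¬ (Q a b c' β γ v ≈ cst (+ 0))

combo : (a b c' : ℕ) (β γ : ℤ₂) → List (ℤ₂ × Vec4 × Vec4) → Raw
combo a b c' β γ [] = cst (+ 0)
combo a b c' β γ ((r , x , y) ∷ ts) =
  ⟦ r ⟧ ⊗ B a b c' β γ x y ⊕ combo a b c' β γ ts

-- scale of L is ℤ₂: the ideal generated by B(L,L) contains 1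
-- (it is always contained in ℤ₂, since B(L,L) ⊆ ℤ₂).
ScaleIsℤ₂ : (a b c' : ℕ) (β γ : ℤ₂) → Set
ScaleIsℤ₂ a b c' β γ =
  Σ (List (ℤ₂ × Vec4 × Vec4)) λ ts → combo a b c' β γ ts ≈ cst (+ 1)

Cong4mod8 : ℤ₂ → ℤ₂ → Set
Cong4mod8 β γ = Σ ℤ₂ λ t → ⟦ β ⟧ ⊕ ⟦ γ ⟧ ≈ c 4 ⊕ c 8 ⊗ ⟦ t ⟧

module Submission where

-- The engine of the proof is Hensel's lemma for X² + X + 2D = 0: with X a root
-- for D = 1 + s, the vector 2^k (X e₀ + e₁) of M has q = −2^{a+1+2k}(1 + 2s).
-- Hence L is isotropic as soon as K represents 2^{a+1+2k} times an odd number
-- (isotropic-if-K-represents).  This rules out every parity pattern of (a,b,c)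
-- except "all even" and "all odd"; "all odd" makes every value of B even,
-- contradicting scale ℤ₂.  For a, b, c even, q_K(z 2^p e₂ + 2^q e₃) =
-- 2^{a+b+c}(z²β + γ), so z²β + γ never has odd 2-adic valuation; for odd β, γ
-- this forces β + γ ≡ 4 (mod 8) (look at β + γ and 25β + γ).

open import Defs
open import Data.Nat as ℕ using (ℕ; zero; suc; _^_; s≤s)
import Data.Nat.Properties as ℕ
import Data.Nat.Divisibility as ℕ∣
open import Data.Nat.Divisibility using (_∣_)
import Data.Nat.Tactic.RingSolver as ℕ-Solver
open import Data.Integer as ℤ using (ℤ; +_; _+_; _-_; _*_; -_)
import Data.Integer.Properties as ℤ
open import Data.Integer.Divisibility.Signed as ℤ∣ using (divides) renaming (_∣_ to _∣ₛ_)
open import Data.Integer.DivMod using (_%ℕ_; _/ℕ_; a≡a%ℕn+[a/ℕn]*n; n%ℕd<d)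
open import Data.Integer.Tactic.RingSolver using (solve-∀)
open import Data.Fin using (zero; suc)
open import Data.List using ([]; _∷_)
open import Data.Product using (Σ; _,_; _×_; proj₁; proj₂)
open import Data.Empty using (⊥-elim)
open import Relation.Nullary using (¬_)
open import Relation.Binary.Bundles using (Setoid)
import Relation.Binary.Reasoning.Setoid as SetoidReasoning
open import Relation.Binary.PropositionalEquality
  using (_≡_; refl; sym; trans; cong; cong₂; subst; subst₂)

2^_ : ℕ → ℤ
2^ n = + (2 ^ n)

2^-+ : ∀ m n → 2^ (m ℕ.+ n) ≡ 2^ m * 2^ n
2^-+ m n = trans (cong +_ (ℕ.^-distribˡ-+-* 2 m n)) (ℤ.pos-* (2 ^ m) (2 ^ n))

2^-+-twice : ∀ x i → 2^ (x ℕ.+ i ℕ.+ i) ≡ 2^ x * 2^ i * 2^ i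
2^-+-twice x i = trans (2^-+ (x ℕ.+ i) i) (cong (_* 2^ i) (2^-+ x i))

2^n∣2^[j+n] : ∀ j n → 2^ n ∣ₛ 2^ (j ℕ.+ n)
2^n∣2^[j+n] j n = divides (2^ j) (2^-+ j n)

2∤1 : ¬ (2^ 1 ∣ₛ + 1)
2∤1 d with ℕ∣.∣1⇒≡1 (ℤ∣.∣⇒∣ᵤ d)
... | ()

2^suc∤2^ : ∀ k → ¬ (2^ (suc k) ∣ₛ 2^ k)
2^suc∤2^ k d = 2∤1 (ℤ∣.*-cancelʳ-∣ (2^ k) {{ℕ.m^n≢0 2 k}}
  (subst₂ _∣ₛ_ (2^-+ 1 k) (sym (ℤ.*-identityˡ (2^ k))) d))

-- x ≡ y (mod m), i.e. m divides x − y.  A record, so that unification sees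
-- x, y and m rather than the unfolded difference.  It is an equivalence
-- relation compatible with +, − and ·.
infix 4 _≡_[mod_]
record _≡_[mod_] (x y m : ℤ) : Set where
  constructor by-∣
  field divides-difference : m ∣ₛ x - y
open _≡_[mod_] public

mod-reflexive : ∀ {m x y} → x ≡ y → x ≡ y [mod m ]
mod-reflexive {m} {x} refl = by-∣ (divides (+ 0) (trans (ℤ.+-inverseʳ x) (sym (ℤ.*-zeroˡ m))))

mod-refl : ∀ {m} x → x ≡ x [mod m ]
mod-refl x = mod-reflexive refl

mod-sym : ∀ {m x y} → x ≡ y [mod m ] → y ≡ x [mod m ]
mod-sym {m} {x} {y} (by-∣ e) = by-∣ (subst (m ∣ₛ_) (lemma x y) (ℤ∣.∣m⇒∣-m e))
  where lemma : ∀ a b → - (a - b) ≡ b - a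
        lemma = solve-∀

mod-trans : ∀ {m x y z} → x ≡ y [mod m ] → y ≡ z [mod m ] → x ≡ z [mod m ]
mod-trans {m} {x} {y} {z} (by-∣ e) (by-∣ f) =
  by-∣ (subst (m ∣ₛ_) (lemma x y z) (ℤ∣.∣m∣n⇒∣m+n e f))
  where lemma : ∀ a b c → (a - b) + (b - c) ≡ a - c
        lemma = solve-∀

mod-+ : ∀ {m x y x' y'} → x ≡ x' [mod m ] → y ≡ y' [mod m ] → x + y ≡ x' + y' [mod m ]
mod-+ {m} {x} {y} {x'} {y'} (by-∣ e) (by-∣ f) =
  by-∣ (subst (m ∣ₛ_) (lemma x y x' y') (ℤ∣.∣m∣n⇒∣m+n e f))
  where lemma : ∀ a b a' b' → (a - a') + (b - b') ≡ (a + b) - (a' + b')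
        lemma = solve-∀

mod-* : ∀ {m x y x' y'} → x ≡ x' [mod m ] → y ≡ y' [mod m ] → x * y ≡ x' * y' [mod m ]
mod-* {m} {x} {y} {x'} {y'} (by-∣ e) (by-∣ f) = by-∣ (subst (m ∣ₛ_) (lemma x y x' y')
    (ℤ∣.∣m∣n⇒∣m+n (ℤ∣.∣m⇒∣m*n y e) (ℤ∣.∣n⇒∣m*n x' f)))
  where lemma : ∀ a b a' b' → (a - a') * b + a' * (b - b') ≡ a * b - a' * b'
        lemma = solve-∀

mod-neg : ∀ {m x y} → x ≡ y [mod m ] → - x ≡ - y [mod m ]
mod-neg {m} {x} {y} (by-∣ e) = by-∣ (subst (m ∣ₛ_) (lemma x y) (ℤ∣.∣m⇒∣-m e))
  where lemma : ∀ a b → - (a - b) ≡ - a - - b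
        lemma = solve-∀

mod-1 : ∀ x y → x ≡ y [mod + 1 ]
mod-1 x y = by-∣ (divides (x - y) (sym (ℤ.*-identityʳ (x - y))))

mod-weaken : ∀ {m m' x y} → m ∣ₛ m' → x ≡ y [mod m' ] → x ≡ y [mod m ]
mod-weaken m∣m' (by-∣ e) = by-∣ (ℤ∣.∣-trans m∣m' e)

-- The relation _≈_ of Defs, wrapped in a record so that both sides stay
-- visible to unification (the bare function type unfolds and loses them).
infix 4 _≋_
record _≋_ (x y : Raw) : Set where
  constructor mod2^
  field congruent : ∀ n → x n ≡ y n [mod 2^ n ]
open _≋_ public

≈⇒≋ : ∀ {x y} → x ≈ y → x ≋ y
≈⇒≋ e = mod2^ λ n → by-∣ (ℤ∣.∣ᵤ⇒∣ (e n))

≋⇒≈ : ∀ {x y} → x ≋ y → x ≈ y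
≋⇒≈ e n = ℤ∣.∣⇒∣ᵤ (divides-difference (congruent e n))

≋-pointwise : ∀ {x y : Raw} → (∀ n → x n ≡ y n) → x ≋ y
≋-pointwise e = mod2^ λ n → mod-reflexive (e n)

≋-refl : ∀ {x} → x ≋ x
≋-refl = ≋-pointwise λ _ → refl

≋-sym : ∀ {x y} → x ≋ y → y ≋ x
≋-sym e = mod2^ λ n → mod-sym (congruent e n)

≋-trans : ∀ {x y z} → x ≋ y → y ≋ z → x ≋ z
≋-trans e f = mod2^ λ n → mod-trans (congruent e n) (congruent f n)

⊕-cong : ∀ {x y x' y'} → x ≋ x' → y ≋ y' → x ⊕ y ≋ x' ⊕ y'
⊕-cong e f = mod2^ λ n → mod-+ (congruent e n) (congruent f n)

⊗-cong : ∀ {x y x' y'} → x ≋ x' → y ≋ y' → x ⊗ y ≋ x' ⊗ y'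
⊗-cong e f = mod2^ λ n → mod-* (congruent e n) (congruent f n)

⊗-congˡ : ∀ {x y y'} → y ≋ y' → x ⊗ y ≋ x ⊗ y'
⊗-congˡ {x} = ⊗-cong (≋-refl {x})

≋-setoid : Setoid _ _
≋-setoid = record
  { Carrier = Raw ; _≈_ = _≋_
  ; isEquivalence = record { refl = ≋-refl ; sym = ≋-sym ; trans = ≋-trans } }

module ≋-Reasoning = SetoidReasoning ≋-setoid

1+2·_ : Raw → Raw
1+2· y = c 1 ⊕ c 2 ⊗ y

coherent : (X : ℤ₂) → (λ n → seq X (suc n)) ≋ ⟦ X ⟧
coherent X = ≈⇒≋ (coh X)

from-coherent : (x : Raw) → (λ n → x (suc n)) ≋ x → ℤ₂
from-coherent x e = record { seq = x ; coh = ≋⇒≈ e }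

ι : ℤ → ℤ₂
ι k = from-coherent (cst k) ≋-refl

infixl 6 _+₂_
infixl 7 _*₂_
_+₂_ : ℤ₂ → ℤ₂ → ℤ₂
X +₂ Y = from-coherent (⟦ X ⟧ ⊕ ⟦ Y ⟧) (⊕-cong (coherent X) (coherent Y))

_*₂_ : ℤ₂ → ℤ₂ → ℤ₂
X *₂ Y = from-coherent (⟦ X ⟧ ⊗ ⟦ Y ⟧) (⊗-cong (coherent X) (coherent Y))

tail : (X : ℤ₂) → ∀ n j → seq X (j ℕ.+ n) ≡ seq X n [mod 2^ n ]
tail X n zero = mod-refl (seq X n)
tail X n (suc j) =
  mod-trans (mod-weaken (2^n∣2^[j+n] j n) (congruent (coherent X) (j ℕ.+ n))) (tail X n j)

-- If X ≡ r (mod 2^m) then X = r + 2^m Y in ℤ₂: the quotients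
-- (X_{n+m} − r) / 2^m form a coherent sequence Y.  Opaque: Y is only ever
-- used through this equation, and unfolding its quotients is costly.
opaque
  divide : (X : ℤ₂) (m : ℕ) (r : ℤ) → seq X m ≡ r [mod 2^ m ] →
           Σ ℤ₂ λ Y → ⟦ X ⟧ ≋ cst r ⊕ pow2 m ⊗ ⟦ Y ⟧
  divide X m r X≡r = Y , mod2^ X≡r+2^mY
    where
    shifted≡r : ∀ n → seq X (n ℕ.+ m) ≡ r [mod 2^ m ]
    shifted≡r n = mod-trans (tail X m n) X≡r
    quotient : ℕ → ℤ
    quotient n = _∣ₛ_.quotient (divides-difference (shifted≡r n))
    shifted-expansion : ∀ n → seq X (n ℕ.+ m) ≡ r + 2^ m * quotient n
    shifted-expansion n = trans (sym (lemma (seq X (n ℕ.+ m)) r))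
      (cong (_+_ r) (trans (_∣ₛ_.equality (divides-difference (shifted≡r n)))
                           (ℤ.*-comm (quotient n) (2^ m))))
      where lemma : ∀ a r → r + (a - r) ≡ a
            lemma = solve-∀
    -- (q_{n+1} − q_n)·2^m = X_{n+1+m} − X_{n+m}, which 2^{n+m} divides
    quotient-coherent : ∀ n → quotient (suc n) ≡ quotient n [mod 2^ n ]
    quotient-coherent n = by-∣ (ℤ∣.*-cancelʳ-∣ (2^ m) {{ℕ.m^n≢0 2 m}}
      (subst₂ _∣ₛ_ (2^-+ n m)
        (trans (cong₂ _-_ (shifted-expansion (suc n)) (shifted-expansion n))
               (lemma r (2^ m) (quotient (suc n)) (quotient n)))
        (divides-difference (congruent (coherent X) (n ℕ.+ m)))))
      where lemma : ∀ r p q q' → (r + p * q) - (r + p * q') ≡ (q - q') * p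
            lemma = solve-∀
    Y : ℤ₂
    Y = from-coherent quotient (mod2^ quotient-coherent)
    X≡r+2^mY : ∀ n → seq X n ≡ r + 2^ m * quotient n [mod 2^ n ]
    X≡r+2^mY n = mod-trans
      (mod-sym (subst (λ i → seq X i ≡ seq X n [mod 2^ n ]) (ℕ.+-comm m n) (tail X n m)))
      (mod-reflexive (shifted-expansion n))

residue : ∀ x r q → x ≡ r + q * + 2 → x ≡ r [mod 2^ 1 ]
residue x r q refl = by-∣ (divides q (lemma r q))
  where lemma : ∀ r q → r + q * + 2 - r ≡ q * + 2
        lemma = solve-∀

data Parity (X : ℤ₂) : Set where
  even : (Y : ℤ₂) → ⟦ X ⟧ ≋ c 2 ⊗ ⟦ Y ⟧ → Parity X
  odd  : (Y : ℤ₂) → ⟦ X ⟧ ≋ 1+2· ⟦ Y ⟧ → Parity X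

parity : (X : ℤ₂) → Parity X
parity X with seq X 1 %ℕ 2 | n%ℕd<d (seq X 1) 2 | a≡a%ℕn+[a/ℕn]*n (seq X 1) 2
... | 0 | _ | e with divide X 1 (+ 0) (residue (seq X 1) (+ 0) (seq X 1 /ℕ 2) e)
...   | Y , X≋0+2Y = even Y (≋-trans X≋0+2Y (≋-pointwise λ n → ℤ.+-identityˡ (+ 2 * seq Y n)))
parity X | 1 | _ | e with divide X 1 (+ 1) (residue (seq X 1) (+ 1) (seq X 1 /ℕ 2) e)
...   | Y , X≋1+2Y = odd Y X≋1+2Y
parity X | suc (suc _) | s≤s (s≤s ()) | _

data Valuation (k : ℕ) (X : ℤ₂) : Set where
  exact     : (j : ℕ) → j ℕ.< k → (s : ℤ₂) → ⟦ X ⟧ ≋ pow2 j ⊗ 1+2· ⟦ s ⟧ → Valuation k X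
  divisible : (Y : ℤ₂) → ⟦ X ⟧ ≋ pow2 k ⊗ ⟦ Y ⟧ → Valuation k X

valuation : ∀ k X → Valuation k X
valuation zero X = divisible X (≋-pointwise λ n → sym (ℤ.*-identityˡ (seq X n)))
valuation (suc k) X with valuation k X
... | exact j j<k s X≋2^j[1+2s] = exact j (ℕ.m<n⇒m<1+n j<k) s X≋2^j[1+2s]
... | divisible Y X≋2^kY with parity Y
...   | odd s Y≋1+2s = exact k (ℕ.n<1+n k) s (≋-trans X≋2^kY (⊗-congˡ {pow2 k} Y≋1+2s))
...   | even Y' Y≋2Y' =
  divisible Y' (≋-trans X≋2^kY (≋-trans (⊗-congˡ {pow2 k} Y≋2Y') (≋-pointwise λ n → absorb-2 (seq Y' n))))
  where
  absorb-2 : ∀ y → 2^ k * (+ 2 * y) ≡ 2^ (suc k) * y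
  absorb-2 y = trans (lemma (2^ k) y) (cong (_* y) (sym (2^-+ 1 k)))
    where lemma : ∀ p y → p * (+ 2 * y) ≡ + 2 * p * y
          lemma = solve-∀

-- With X = 2y the equation reads y = g_d(y) for g_d(y) = −d − 2y², and g_d is a
-- 2-adic contraction: g_d(y) − g_d(y') = 2(y' − y)(y' + y).
contraction : ℤ → ℤ → ℤ
contraction d y = - d - + 2 * (y * y)

contraction-cong : ∀ {m d d' y y'} → d ≡ d' [mod m ] → y ≡ y' [mod m ] →
                   contraction d y ≡ contraction d' y' [mod m ]
contraction-cong d≡d' y≡y' =
  mod-+ (mod-neg d≡d') (mod-neg (mod-* (mod-refl (+ 2)) (mod-* y≡y' y≡y')))

contraction-contracts : ∀ {k} d {y y'} → y ≡ y' [mod 2^ k ] →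
                        contraction d y ≡ contraction d y' [mod 2^ (suc k) ]
contraction-contracts {k} d {y} {y'} (by-∣ 2^k∣y-y') = by-∣ (subst₂ _∣ₛ_ (sym (2^-+ 1 k))
  (sym (difference d y y'))
  (ℤ∣.*-monoʳ-∣ (+ 2) (ℤ∣.∣m⇒∣m*n (- (y + y')) 2^k∣y-y')))
  where difference : ∀ d a b → (- d - + 2 * (a * a)) - (- d - + 2 * (b * b)) ≡ + 2 * ((a - b) * - (a + b))
        difference = solve-∀

iterate : ℤ → ℕ → ℤ
iterate d zero = + 0
iterate d (suc k) = contraction d (iterate d k)

iterate-step : ∀ d k → iterate d (suc k) ≡ iterate d k [mod 2^ k ]
iterate-step d zero = mod-1 (iterate d 1) (iterate d 0)
iterate-step d (suc k) = contraction-contracts {k} d (iterate-step d k)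

iterate-cong : ∀ {m d d'} k → d ≡ d' [mod m ] → iterate d k ≡ iterate d' k [mod m ]
iterate-cong zero d≡d' = mod-refl (+ 0)
iterate-cong (suc k) d≡d' = contraction-cong d≡d' (iterate-cong k d≡d')

hensel : (D : ℤ₂) → Σ ℤ₂ λ X → ⟦ X ⟧ ⊗ ⟦ X ⟧ ⊕ ⟦ X ⟧ ⊕ c 2 ⊗ ⟦ D ⟧ ≋ cst (+ 0)
hensel D = ι (+ 2) *₂ Y , mod2^ root
  where
  y : ℕ → ℤ
  y n = iterate (seq D n) n
  Y : ℤ₂
  Y = from-coherent y (mod2^ λ n →
    mod-trans (iterate-step (seq D (suc n)) n) (iterate-cong n (congruent (coherent D) n)))
  root : ∀ n → (+ 2 * y n) * (+ 2 * y n) + + 2 * y n + + 2 * seq D n ≡ + 0 [mod 2^ n ]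
  root n = by-∣ (subst (2^ n ∣ₛ_) (fixed-point-equation (seq D n) (y n))
    (ℤ∣.∣m⇒∣-m (ℤ∣.∣n⇒∣m*n (+ 2) (divides-difference (iterate-step (seq D n) n)))))
    where fixed-point-equation : ∀ d y → - (+ 2 * ((- d - + 2 * (y * y)) - y))
                                          ≡ (+ 2 * y) * (+ 2 * y) + + 2 * y + + 2 * d - + 0
          fixed-point-equation = solve-∀

1≢0-mod-2 : ¬ (+ 1 ≡ + 0 [mod 2^ 1 ])
1≢0-mod-2 (by-∣ 2∣1) = 2∤1 2∣1

∣⇒≡0 : ∀ {m x} → m ∣ₛ x → x ≡ + 0 [mod m ]
∣⇒≡0 {m} {x} m∣x = by-∣ (subst (m ∣ₛ_) (sym (ℤ.+-identityʳ x)) m∣x)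

-- A unit of ℤ₂ is odd: if β = 2Y then βu ≡ 0 (mod 2), not 1.
unit-odd : (β : ℤ₂) → IsUnit β → Σ ℤ₂ λ s → ⟦ β ⟧ ≋ 1+2· ⟦ s ⟧
unit-odd β (u , βu≈1) with parity β
... | odd s β≋1+2s = s , β≋1+2s
... | even Y β≋2Y = ⊥-elim (1≢0-mod-2 (mod-trans (mod-sym βu≡1) βu≡0))
  where
  βu≡1 : seq β 1 * seq u 1 ≡ + 1 [mod 2^ 1 ]
  βu≡1 = congruent (≈⇒≋ {⟦ β ⟧ ⊗ ⟦ u ⟧} {cst (+ 1)} βu≈1) 1
  βu≡0 : seq β 1 * seq u 1 ≡ + 0 [mod 2^ 1 ]
  βu≡0 = mod-trans (mod-* (congruent β≋2Y 1) (mod-refl (seq u 1)))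
    (∣⇒≡0 (ℤ∣.∣m⇒∣m*n (seq u 1) (ℤ∣.∣m⇒∣m*n (seq Y 1) ℤ∣.∣-refl)))

-- With a, b, c ≥ 1 every value B(x, y) is even, hence so is every element
-- of the ideal generated by B(L, L): the scale is then inside 2ℤ₂.
2∣2^suc : ∀ a → 2^ 1 ∣ₛ 2^ (suc a)
2∣2^suc a = divides (2^ a) (trans (2^-+ 1 a) (ℤ.*-comm (2^ 1) (2^ a)))

B-even : ∀ a b c' β γ x y → 2^ 1 ∣ₛ B (suc a) (suc b) (suc c') β γ x y 1
B-even a b c' β γ x y = ℤ∣.∣m∣n⇒∣m+n (ℤ∣.∣m∣n⇒∣m+n
  (ℤ∣.∣m⇒∣m*n _ (2∣2^suc a))
  (ℤ∣.∣m⇒∣m*n _ (ℤ∣.∣m⇒∣m*n _ (ℤ∣.∣m⇒∣m*n _ (2∣2^suc b)))))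
  (ℤ∣.∣m⇒∣m*n _ (ℤ∣.∣m⇒∣m*n _ (ℤ∣.∣m⇒∣m*n _ (2∣2^suc c'))))

combo-even : ∀ a b c' β γ ts → 2^ 1 ∣ₛ combo (suc a) (suc b) (suc c') β γ ts 1
combo-even a b c' β γ [] = ℤ∣.∣n⇒∣m*n (+ 0) ℤ∣.∣-refl
combo-even a b c' β γ ((r , x , y) ∷ ts) =
  ℤ∣.∣m∣n⇒∣m+n (ℤ∣.∣n⇒∣m*n (seq r 1) (B-even a b c' β γ x y)) (combo-even a b c' β γ ts)

scale-of-odd-exponents : ∀ a b c' β γ → ¬ ScaleIsℤ₂ (suc a) (suc b) (suc c') β γ
scale-of-odd-exponents a b c' β γ (ts , combo≈1) =
  1≢0-mod-2 (mod-trans (mod-sym combo≡1) (∣⇒≡0 (combo-even a b c' β γ ts)))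
  where combo≡1 : combo (suc a) (suc b) (suc c') β γ ts 1 ≡ + 1 [mod 2^ 1 ]
        combo≡1 = congruent (≈⇒≋ {combo (suc a) (suc b) (suc c') β γ ts} {cst (+ 1)} combo≈1) 1

qK : (b c' : ℕ) (β γ z w : ℤ₂) → Raw
qK b c' β γ z w = pow2 b ⊗ ⟦ β ⟧ ⊗ ⟦ z ⟧ ⊗ ⟦ z ⟧ ⊕ pow2 c' ⊗ ⟦ γ ⟧ ⊗ ⟦ w ⟧ ⊗ ⟦ w ⟧

-- Let X² + X + 2(1 + s) = 0 (Hensel).  Then q_M(2^k (X e₀ + e₁)) =
-- 2^{a+1+2k}(X² + X + 1) = −2^{a+1+2k}(1 + 2s), so a vector of K of length
-- 2^{a+1+2k}(1 + 2s) completes it to a nonzero isotropic vector of L.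
isotropic-if-K-represents : ∀ a b c' β γ (z w s : ℤ₂) (k : ℕ) →
  qK b c' β γ z w ≋ pow2 (a ℕ.+ 1 ℕ.+ k ℕ.+ k) ⊗ 1+2· ⟦ s ⟧ → ¬ Anisotropic a b c' β γ
isotropic-if-K-represents a b c' β γ z w s k K-represents anisotropic =
  anisotropic v v≢0 (≋⇒≈ q[v]≋0)
  where
  open ≋-Reasoning
  e : ℕ
  e = a ℕ.+ 1 ℕ.+ k ℕ.+ k
  X : ℤ₂
  X = proj₁ (hensel (ι (+ 1) +₂ s))
  root : ⟦ X ⟧ ⊗ ⟦ X ⟧ ⊕ ⟦ X ⟧ ⊕ c 2 ⊗ ⟦ ι (+ 1) +₂ s ⟧ ≋ cst (+ 0)
  root = proj₂ (hensel (ι (+ 1) +₂ s))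
  v : Vec4
  v zero = ι (2^ k) *₂ X
  v (suc zero) = ι (2^ k)
  v (suc (suc zero)) = z
  v (suc (suc (suc zero))) = w
  -- the e₁-coordinate 2^k of v is not 0 modulo 2^{k+1}
  v≢0 : ¬ IsZeroVec v
  v≢0 v≈0 = 2^suc∤2^ k (subst (2^ (suc k) ∣ₛ_) (ℤ.+-identityʳ (2^ k))
    (divides-difference (congruent (≈⇒≋ {⟦ v (suc zero) ⟧} {cst (+ 0)} (v≈0 (suc zero))) (suc k))))
  q-M : ∀ n → Q a b c' β γ v n ≡ 2^ e * (seq X n * seq X n + seq X n + + 1) + qK b c' β γ z w n
  q-M n = trans (expand (2^ a) (2^ k) (seq X n)
      (2^ b * seq β n * seq z n * seq z n) (2^ c' * seq γ n * seq w n * seq w n))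
    (cong (λ p → p * (seq X n * seq X n + seq X n + + 1) + qK b c' β γ z w n) (sym 2^e))
    where
    expand : ∀ A P X Kβ Kγ →
      A * (+ 2 * (P * X) * (P * X) + (P * X) * P + P * (P * X) + + 2 * P * P) + Kβ + Kγ
        ≡ A * + 2 * P * P * (X * X + X + + 1) + (Kβ + Kγ)
    expand = solve-∀
    2^e : 2^ e ≡ 2^ a * + 2 * 2^ k * 2^ k
    2^e = trans (2^-+-twice (a ℕ.+ 1) k) (cong (λ p → p * 2^ k * 2^ k) (2^-+ a 1))
  q[v]≋0 : Q a b c' β γ v ≋ cst (+ 0)
  q[v]≋0 = begin
    Q a b c' β γ v
      ≈⟨ ≋-pointwise q-M ⟩
    pow2 e ⊗ (⟦ X ⟧ ⊗ ⟦ X ⟧ ⊕ ⟦ X ⟧ ⊕ c 1) ⊕ qK b c' β γ z w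
      ≈⟨ ⊕-cong (≋-refl {pow2 e ⊗ (⟦ X ⟧ ⊗ ⟦ X ⟧ ⊕ ⟦ X ⟧ ⊕ c 1)}) K-represents ⟩
    pow2 e ⊗ (⟦ X ⟧ ⊗ ⟦ X ⟧ ⊕ ⟦ X ⟧ ⊕ c 1) ⊕ pow2 e ⊗ 1+2· ⟦ s ⟧
      ≈⟨ ≋-pointwise (λ n → factor (2^ e) (seq X n) (seq s n)) ⟩
    pow2 e ⊗ (⟦ X ⟧ ⊗ ⟦ X ⟧ ⊕ ⟦ X ⟧ ⊕ c 2 ⊗ ⟦ ι (+ 1) +₂ s ⟧)
      ≈⟨ ⊗-congˡ {pow2 e} root ⟩
    pow2 e ⊗ cst (+ 0)
      ≈⟨ ≋-pointwise (λ n → ℤ.*-zeroʳ (2^ e)) ⟩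
    cst (+ 0) ∎
    where factor : ∀ p x s → p * (x * x + x + + 1) + p * (+ 1 + + 2 * s) ≡ p * (x * x + x + + 2 * (+ 1 + s))
          factor = solve-∀

-- If b + 2i = a + 1 + 2k, then q_K(2^i e₂) = 2^{a+1+2k} β with β odd.
β-exponent-clash : ∀ a b c' β γ (s : ℤ₂) (i k : ℕ) → ⟦ β ⟧ ≋ 1+2· ⟦ s ⟧ →
  b ℕ.+ i ℕ.+ i ≡ a ℕ.+ 1 ℕ.+ k ℕ.+ k → ¬ Anisotropic a b c' β γ
β-exponent-clash a b c' β γ s i k β-odd exponents =
  isotropic-if-K-represents a b c' β γ (ι (2^ i)) (ι (+ 0)) s k (begin
    qK b c' β γ (ι (2^ i)) (ι (+ 0))          ≈⟨ ≋-pointwise value ⟩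
    pow2 (a ℕ.+ 1 ℕ.+ k ℕ.+ k) ⊗ ⟦ β ⟧        ≈⟨ ⊗-congˡ {pow2 (a ℕ.+ 1 ℕ.+ k ℕ.+ k)} β-odd ⟩
    pow2 (a ℕ.+ 1 ℕ.+ k ℕ.+ k) ⊗ 1+2· ⟦ s ⟧ ∎)
  where
  open ≋-Reasoning
  value : ∀ n → 2^ b * seq β n * 2^ i * 2^ i + 2^ c' * seq γ n * + 0 * + 0
                  ≡ 2^ (a ℕ.+ 1 ℕ.+ k ℕ.+ k) * seq β n
  value n = trans (lemma (2^ b) (seq β n) (2^ i) (2^ c') (seq γ n))
    (cong (_* seq β n) (trans (sym (2^-+-twice b i)) (cong 2^_ exponents)))
    where lemma : ∀ B β P C γ → B * β * P * P + C * γ * + 0 * + 0 ≡ B * P * P * β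
          lemma = solve-∀

-- If c + 2i = a + 1 + 2k, then q_K(2^i e₃) = 2^{a+1+2k} γ with γ odd.
γ-exponent-clash : ∀ a b c' β γ (s : ℤ₂) (i k : ℕ) → ⟦ γ ⟧ ≋ 1+2· ⟦ s ⟧ →
  c' ℕ.+ i ℕ.+ i ≡ a ℕ.+ 1 ℕ.+ k ℕ.+ k → ¬ Anisotropic a b c' β γ
γ-exponent-clash a b c' β γ s i k γ-odd exponents =
  isotropic-if-K-represents a b c' β γ (ι (+ 0)) (ι (2^ i)) s k (begin
    qK b c' β γ (ι (+ 0)) (ι (2^ i))          ≈⟨ ≋-pointwise value ⟩
    pow2 (a ℕ.+ 1 ℕ.+ k ℕ.+ k) ⊗ ⟦ γ ⟧        ≈⟨ ⊗-congˡ {pow2 (a ℕ.+ 1 ℕ.+ k ℕ.+ k)} γ-odd ⟩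
    pow2 (a ℕ.+ 1 ℕ.+ k ℕ.+ k) ⊗ 1+2· ⟦ s ⟧ ∎)
  where
  open ≋-Reasoning
  value : ∀ n → 2^ b * seq β n * + 0 * + 0 + 2^ c' * seq γ n * 2^ i * 2^ i
                  ≡ 2^ (a ℕ.+ 1 ℕ.+ k ℕ.+ k) * seq γ n
  value n = trans (lemma (2^ b) (seq β n) (2^ i) (2^ c') (seq γ n))
    (cong (_* seq γ n) (trans (sym (2^-+-twice c' i)) (cong 2^_ exponents)))
    where lemma : ∀ B β P C γ → B * β * + 0 * + 0 + C * γ * P * P ≡ C * P * P * γ
          lemma = solve-∀

qK-rescaled : ∀ h₁ h₂ h₃ β γ (z : ℤ) →
  qK (h₂ ℕ.+ h₂) (h₃ ℕ.+ h₃) β γ (ι (z * 2^ (h₁ ℕ.+ h₃))) (ι (2^ (h₁ ℕ.+ h₂)))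
    ≋ pow2 (h₁ ℕ.+ h₁ ℕ.+ (h₂ ℕ.+ h₂) ℕ.+ (h₃ ℕ.+ h₃)) ⊗ (cst (z * z) ⊗ ⟦ β ⟧ ⊕ ⟦ γ ⟧)
qK-rescaled h₁ h₂ h₃ β γ z = ≋-pointwise λ n →
  trans (regroup (2^ b) (seq β n) z (2^ p) (2^ c') (seq γ n) (2^ q))
    (trans (cong₂ (λ x y → x * (z * z * seq β n) + y * seq γ n) 2^b4^p 2^c4^q)
      (sym (ℤ.*-distribˡ-+ (2^ N) (z * z * seq β n) (seq γ n))))
  where
  b c' N p q : ℕ
  b = h₂ ℕ.+ h₂
  c' = h₃ ℕ.+ h₃
  N = h₁ ℕ.+ h₁ ℕ.+ b ℕ.+ c'
  p = h₁ ℕ.+ h₃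
  q = h₁ ℕ.+ h₂
  regroup : ∀ B β z P C γ Q →
    B * β * (z * P) * (z * P) + C * γ * Q * Q ≡ B * P * P * (z * z * β) + C * Q * Q * γ
  regroup = solve-∀
  2^b4^p : 2^ b * 2^ p * 2^ p ≡ 2^ N
  2^b4^p = trans (sym (2^-+-twice b p)) (cong 2^_ (exponent h₁ h₂ h₃))
    where exponent : ∀ h₁ h₂ h₃ → h₂ ℕ.+ h₂ ℕ.+ (h₁ ℕ.+ h₃) ℕ.+ (h₁ ℕ.+ h₃)
                                    ≡ h₁ ℕ.+ h₁ ℕ.+ (h₂ ℕ.+ h₂) ℕ.+ (h₃ ℕ.+ h₃)
          exponent = ℕ-Solver.solve-∀
  2^c4^q : 2^ c' * 2^ q * 2^ q ≡ 2^ N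
  2^c4^q = trans (sym (2^-+-twice c' q)) (cong 2^_ (exponent h₁ h₂ h₃))
    where exponent : ∀ h₁ h₂ h₃ → h₃ ℕ.+ h₃ ℕ.+ (h₁ ℕ.+ h₂) ℕ.+ (h₁ ℕ.+ h₂)
                                    ≡ h₁ ℕ.+ h₁ ℕ.+ (h₂ ℕ.+ h₂) ℕ.+ (h₃ ℕ.+ h₃)
          exponent = ℕ-Solver.solve-∀

-- Hence, for even a, b, c, z²β + γ = 2^{1+2j}(1 + 2s) would make K represent
-- 2^{N+1+2j}(1 + 2s) = 2^{a+1+2k}(1 + 2s) with k = h₂ + h₃ + j.
odd-valuation-clash : ∀ h₁ h₂ h₃ β γ (z : ℤ) (j : ℕ) (s : ℤ₂) →
  cst (z * z) ⊗ ⟦ β ⟧ ⊕ ⟦ γ ⟧ ≋ pow2 (1 ℕ.+ j ℕ.+ j) ⊗ 1+2· ⟦ s ⟧ →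
  ¬ Anisotropic (h₁ ℕ.+ h₁) (h₂ ℕ.+ h₂) (h₃ ℕ.+ h₃) β γ
odd-valuation-clash h₁ h₂ h₃ β γ z j s z²β+γ-valuation =
  isotropic-if-K-represents a (h₂ ℕ.+ h₂) (h₃ ℕ.+ h₃) β γ
    (ι (z * 2^ (h₁ ℕ.+ h₃))) (ι (2^ (h₁ ℕ.+ h₂))) s k (begin
    qK (h₂ ℕ.+ h₂) (h₃ ℕ.+ h₃) β γ (ι (z * 2^ (h₁ ℕ.+ h₃))) (ι (2^ (h₁ ℕ.+ h₂)))
                                                    ≈⟨ qK-rescaled h₁ h₂ h₃ β γ z ⟩
    pow2 N ⊗ (cst (z * z) ⊗ ⟦ β ⟧ ⊕ ⟦ γ ⟧)         ≈⟨ ⊗-congˡ {pow2 N} z²β+γ-valuation ⟩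
    pow2 N ⊗ (pow2 (1 ℕ.+ j ℕ.+ j) ⊗ 1+2· ⟦ s ⟧)   ≈⟨ ≋-pointwise merge ⟩
    pow2 (a ℕ.+ 1 ℕ.+ k ℕ.+ k) ⊗ 1+2· ⟦ s ⟧ ∎)
  where
  open ≋-Reasoning
  a N k : ℕ
  a = h₁ ℕ.+ h₁
  N = a ℕ.+ (h₂ ℕ.+ h₂) ℕ.+ (h₃ ℕ.+ h₃)
  k = h₂ ℕ.+ h₃ ℕ.+ j
  merge : ∀ n → 2^ N * (2^ (1 ℕ.+ j ℕ.+ j) * (1+2· ⟦ s ⟧) n)
                  ≡ 2^ (a ℕ.+ 1 ℕ.+ k ℕ.+ k) * (1+2· ⟦ s ⟧) n
  merge n = trans (sym (ℤ.*-assoc (2^ N) _ ((1+2· ⟦ s ⟧) n)))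
    (cong (_* (1+2· ⟦ s ⟧) n) (trans (sym (2^-+ N (1 ℕ.+ j ℕ.+ j))) (cong 2^_ (exponent h₁ h₂ h₃ j))))
    where exponent : ∀ h₁ h₂ h₃ j → h₁ ℕ.+ h₁ ℕ.+ (h₂ ℕ.+ h₂) ℕ.+ (h₃ ℕ.+ h₃) ℕ.+ (1 ℕ.+ j ℕ.+ j)
                                       ≡ h₁ ℕ.+ h₁ ℕ.+ 1 ℕ.+ (h₂ ℕ.+ h₃ ℕ.+ j) ℕ.+ (h₂ ℕ.+ h₃ ℕ.+ j)
          exponent = ℕ-Solver.solve-∀

sum-of-odds : ∀ β γ (sβ sγ : ℤ₂) → ⟦ β ⟧ ≋ 1+2· ⟦ sβ ⟧ → ⟦ γ ⟧ ≋ 1+2· ⟦ sγ ⟧ →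
  ⟦ β ⟧ ⊕ ⟦ γ ⟧ ≋ c 2 ⊗ ⟦ ι (+ 1) +₂ sβ +₂ sγ ⟧
sum-of-odds β γ sβ sγ β-odd γ-odd =
  ≋-trans (⊕-cong β-odd γ-odd) (≋-pointwise λ n → lemma (seq sβ n) (seq sγ n))
  where lemma : ∀ a b → (+ 1 + + 2 * a) + (+ 1 + + 2 * b) ≡ + 2 * (+ 1 + a + b)
        lemma = solve-∀

double : ∀ j x → c 2 ⊗ (pow2 j ⊗ x) ≋ pow2 (suc j) ⊗ x
double j x = ≋-pointwise λ n →
  trans (sym (ℤ.*-assoc (+ 2) (2^ j) (x n))) (cong (_* x n) (sym (2^-+ 1 j)))

-- For odd β, γ write β + γ = 2t.  If z²β + γ never has odd valuation, then t
-- is neither odd (β + γ = 2·odd) nor 4·odd (β + γ = 8·odd), and not divisible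
-- by 8 either, since then 25β + γ = 16·(t/8) + 24β = 8·odd.  So t = 2·odd.
sum-≡4-mod-8 : ∀ β γ (sβ sγ : ℤ₂) → ⟦ β ⟧ ≋ 1+2· ⟦ sβ ⟧ → ⟦ γ ⟧ ≋ 1+2· ⟦ sγ ⟧ →
  (∀ (z : ℤ) (j : ℕ) (s : ℤ₂) →
     ¬ (cst (z * z) ⊗ ⟦ β ⟧ ⊕ ⟦ γ ⟧ ≋ pow2 (1 ℕ.+ j ℕ.+ j) ⊗ 1+2· ⟦ s ⟧)) →
  Cong4mod8 β γ
sum-≡4-mod-8 β γ sβ sγ β-odd γ-odd no-odd-valuation = by-valuation (valuation 3 t)
  where
  open ≋-Reasoning
  t : ℤ₂
  t = ι (+ 1) +₂ sβ +₂ sγ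
  β+γ≋2t : ⟦ β ⟧ ⊕ ⟦ γ ⟧ ≋ c 2 ⊗ ⟦ t ⟧
  β+γ≋2t = sum-of-odds β γ sβ sγ β-odd γ-odd
  sum-valuation : ∀ j x → ⟦ t ⟧ ≋ pow2 j ⊗ x →
                  cst (+ 1 * + 1) ⊗ ⟦ β ⟧ ⊕ ⟦ γ ⟧ ≋ pow2 (suc j) ⊗ x
  sum-valuation j x t≋2^jx = begin
    cst (+ 1 * + 1) ⊗ ⟦ β ⟧ ⊕ ⟦ γ ⟧  ≈⟨ ≋-pointwise (λ n → cong (_+ seq γ n) (ℤ.*-identityˡ (seq β n))) ⟩
    ⟦ β ⟧ ⊕ ⟦ γ ⟧                    ≈⟨ β+γ≋2t ⟩
    c 2 ⊗ ⟦ t ⟧                      ≈⟨ ⊗-congˡ {c 2} t≋2^jx ⟩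
    c 2 ⊗ (pow2 j ⊗ x)               ≈⟨ double j x ⟩
    pow2 (suc j) ⊗ x ∎
  by-valuation : Valuation 3 t → Cong4mod8 β γ
  by-valuation (exact 0 _ s t≋odd) =
    ⊥-elim (no-odd-valuation (+ 1) 0 s (sum-valuation 0 (1+2· ⟦ s ⟧) t≋odd))
  by-valuation (exact 1 _ s t≋2odd) = s , ≋⇒≈ (begin
    ⟦ β ⟧ ⊕ ⟦ γ ⟧                     ≈⟨ β+γ≋2t ⟩
    c 2 ⊗ ⟦ t ⟧                       ≈⟨ ⊗-congˡ {c 2} t≋2odd ⟩
    c 2 ⊗ (pow2 1 ⊗ 1+2· ⟦ s ⟧)       ≈⟨ ≋-pointwise (λ n → lemma (seq s n)) ⟩
    c 4 ⊕ c 8 ⊗ ⟦ s ⟧ ∎)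
    where lemma : ∀ y → + 2 * (+ 2 * (+ 1 + + 2 * y)) ≡ + 4 + + 8 * y
          lemma = solve-∀
  by-valuation (exact 2 _ s t≋4odd) =
    ⊥-elim (no-odd-valuation (+ 1) 1 s (sum-valuation 2 (1+2· ⟦ s ⟧) t≋4odd))
  by-valuation (exact (suc (suc (suc _))) (s≤s (s≤s (s≤s ()))) _ _)
  by-valuation (divisible Y t≋8Y) = ⊥-elim (no-odd-valuation (+ 5) 1 s (begin
    cst (+ 5 * + 5) ⊗ ⟦ β ⟧ ⊕ ⟦ γ ⟧              ≈⟨ ≋-pointwise (λ n → split (seq β n) (seq γ n)) ⟩
    (⟦ β ⟧ ⊕ ⟦ γ ⟧) ⊕ c 24 ⊗ ⟦ β ⟧                ≈⟨ ⊕-cong (≋-trans β+γ≋2t (⊗-congˡ {c 2} t≋8Y))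
                                                          (⊗-congˡ {c 24} β-odd) ⟩
    c 2 ⊗ (pow2 3 ⊗ ⟦ Y ⟧) ⊕ c 24 ⊗ 1+2· ⟦ sβ ⟧  ≈⟨ ≋-pointwise (λ n → collect (seq Y n) (seq sβ n)) ⟩
    pow2 3 ⊗ 1+2· ⟦ s ⟧ ∎))
    where
    s : ℤ₂
    s = ι (+ 1) +₂ Y +₂ ι (+ 3) *₂ sβ
    split : ∀ x y → + 5 * + 5 * x + y ≡ (x + y) + + 24 * x
    split = solve-∀
    collect : ∀ y t → + 2 * (+ 8 * y) + + 24 * (+ 1 + + 2 * t) ≡ + 8 * (+ 1 + + 2 * (+ 1 + y + + 3 * t))
    collect = solve-∀

data ParityView : ℕ → Set where
  even : ∀ h → ParityView (h ℕ.+ h)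
  odd  : ∀ h → ParityView (suc (h ℕ.+ h))

parityView : ∀ n → ParityView n
parityView zero = even 0
parityView (suc n) with parityView n
... | even h = odd h
... | odd h = subst ParityView (cong suc (ℕ.+-suc h h)) (even (suc h))

2∣h+h : ∀ h → 2 ∣ h ℕ.+ h
2∣h+h h = ℕ∣.divides h (lemma h)
  where lemma : ∀ h → h ℕ.+ h ≡ h ℕ.* 2
        lemma = ℕ-Solver.solve-∀

-- Exponents of opposite parity are matched by b + 2i = a + 1 + 2k.
odd-over-even : ∀ h h' → suc (h' ℕ.+ h') ℕ.+ h ℕ.+ h ≡ h ℕ.+ h ℕ.+ 1 ℕ.+ h' ℕ.+ h'
odd-over-even = ℕ-Solver.solve-∀

even-over-odd : ∀ h h' → h' ℕ.+ h' ℕ.+ suc h ℕ.+ suc h ≡ suc (h ℕ.+ h) ℕ.+ 1 ℕ.+ h' ℕ.+ h'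
even-over-odd = ℕ-Solver.solve-∀

lemma3p9 : (a b c : ℕ) (β γ : ℤ₂) → IsUnit β → IsUnit γ →
    ScaleIsℤ₂ a b c β γ → Anisotropic a b c β γ →
    (2 ∣ a) × (2 ∣ b) × (2 ∣ c) × Cong4mod8 β γ
lemma3p9 a b c β γ β-unit γ-unit scale anisotropic
  with unit-odd β β-unit | unit-odd γ γ-unit | parityView a | parityView b | parityView c
... | sβ , β-odd | sγ , γ-odd | even h₁ | even h₂ | even h₃ =
  2∣h+h h₁ , 2∣h+h h₂ , 2∣h+h h₃ , sum-≡4-mod-8 β γ sβ sγ β-odd γ-odd
    (λ z j s rep → odd-valuation-clash h₁ h₂ h₃ β γ z j s rep anisotropic)
... | _ | _ | odd h₁ | odd h₂ | odd h₃ =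
  ⊥-elim (scale-of-odd-exponents (h₁ ℕ.+ h₁) (h₂ ℕ.+ h₂) (h₃ ℕ.+ h₃) β γ scale)
... | sβ , β-odd | _ | even h₁ | odd h₂ | _ =
  ⊥-elim (β-exponent-clash (h₁ ℕ.+ h₁) (suc (h₂ ℕ.+ h₂)) c β γ sβ h₁ h₂ β-odd
            (odd-over-even h₁ h₂) anisotropic)
... | sβ , β-odd | _ | odd h₁ | even h₂ | _ =
  ⊥-elim (β-exponent-clash (suc (h₁ ℕ.+ h₁)) (h₂ ℕ.+ h₂) c β γ sβ (suc h₁) h₂ β-odd
            (even-over-odd h₁ h₂) anisotropic)
... | _ | sγ , γ-odd | even h₁ | even h₂ | odd h₃ =
  ⊥-elim (γ-exponent-clash (h₁ ℕ.+ h₁) (h₂ ℕ.+ h₂) (suc (h₃ ℕ.+ h₃)) β γ sγ h₁ h₃ γ-odd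
            (odd-over-even h₁ h₃) anisotropic)
... | _ | sγ , γ-odd | odd h₁ | odd h₂ | even h₃ =
  ⊥-elim (γ-exponent-clash (suc (h₁ ℕ.+ h₁)) (suc (h₂ ℕ.+ h₂)) (h₃ ℕ.+ h₃) β γ sγ (suc h₁) h₃ γ-odd
            (even-over-odd h₁ h₃) anisotropic)
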